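{- Let $n \ge 4$ be an integer, consider the equation $n = k + p_k$ in the positive integer unknown $k$, and define the sequence $(k_j)_{j\ge 0}$ by \[ k_0 = \pi(n), \qquad k_{j+1} = \pi(n-k_j) \quad (j \ge 0). \] (It is known that this sequence eventually either becomes constant, equal to a fixed point $k^{*}$ with $\pi(n-k^*)=k^*$, or eventually alternates between two values $k'$ and $k'' = k'+1$.) Then: (i) If the sequence eventually becomes constant equal to $k^{*}$, then $k^{*}$ is the solution of the equation $n' = k + p_k$, where $n' = \max\{ j + p_j \le n : j \ge 1\}$. In particular, the equation $n = k + p_k$ has a solution if and only if $n' = n$, and in that case $k^{*}$ is the solution. (ii) If the sequence eventually alternates between $k'$ and $k'' = k'+1$, then the equation $n = k + p_k$ has no solution.
   Context: $\pi(x)$ denotes the number of primes less than or equal to $x$, and $p_k$ denotes the $k$th prime number ($p_1=2$). -}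

module Defs where

open import Data.Nat using (ℕ; zero; suc; _+_; _∸_; _≤_)
open import Data.Nat.Primality using (Prime; prime?)
open import Data.Product using (Σ; _×_; ∃; ∃-syntax)
open import Data.Sum using (_⊎_)
open import Relation.Nullary using (yes; no)
open import Relation.Binary.PropositionalEquality using (_≡_)

π : ℕ → ℕ
π zero = 0
π (suc x) with prime? (suc x)
... | yes _ = suc (π x)
... | no _ = π x

-- NthPrime k p : p is the k-th prime p_k (p prime and exactly k primes ≤ p);
-- so p_1 = 2, and k ≥ 1 automatically.
NthPrime : ℕ → ℕ → Set
NthPrime k p = Prime p × π p ≡ k

Solves : ℕ → ℕ → Set
Solves m k = ∃[ p ] (NthPrime k p × m ≡ k + p)

-- the sequence k_0 = π n, k_{j+1} = π (n - k_j)   (note k_j ≤ n, so ∸ is exact)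
kseq : ℕ → ℕ → ℕ
kseq n zero = π n
kseq n (suc j) = π (n ∸ kseq n j)

IsNPrime : ℕ → ℕ → Set
IsNPrime n n' =
  (∃[ j ] Solves n' j) × n' ≤ n ×
  (∀ j p → NthPrime j p → j + p ≤ n → j + p ≤ n')

EventuallyConst : ℕ → ℕ → Set
EventuallyConst n k* = ∃[ J ] (∀ j → J ≤ j → kseq n j ≡ k*)

EventuallyAlt : ℕ → ℕ → Set
EventuallyAlt n k' = ∃[ J ] (∀ j → J ≤ j →
  (kseq n j ≡ k' × kseq n (suc j) ≡ suc k') ⊎
  (kseq n j ≡ suc k' × kseq n (suc j) ≡ k'))

-- A solution k of n = k + p_k is exactly a fixed point of the antitone map
-- k ↦ π (n ∸ k) that drives the sequence.  An antitone map on ℕ has at most one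
-- fixed point, and none at all once some a satisfies a < f a and f (a + 1) ≤ a;
-- an alternating pair k', k' + 1 is such an a.  For the maximal j + p_j = n' ≤ n,
-- p_j ≤ n ∸ j gives j ≤ π (n ∸ j), and maximality rules out p_{j+1} ≤ n ∸ (j + 1),
-- so π (n ∸ (j + 1)) ≤ j; hence j is the fixed point k*.
module Submission where

open import Defs
open import Data.Nat using (ℕ; zero; suc; _+_; _∸_; _≤_; _<_; _≥_; s≤s; z<s; _≤?_; NonZero; >-nonZero⁻¹)
open import Data.Nat.Properties
open import Data.Nat.Primality using (Prime; prime?; prime⇒nonZero)
open import Data.Product using (_×_; _,_; ∃-syntax)
open import Data.Sum using (inj₁; inj₂)
open import Relation.Binary.Core using (_Preserves_⟶_)
open import Relation.Nullary using (¬_; yes; no; contradiction)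
open import Relation.Binary.PropositionalEquality
  using (_≡_; _≢_; refl; sym; trans; cong; subst; subst₂)

π-≤-suc : ∀ x → π x ≤ π (suc x)
π-≤-suc x with prime? (suc x)
... | yes _ = n≤1+n (π x)
... | no _  = ≤-refl

π-mono-≤ : π Preserves _≤_ ⟶ _≤_
π-mono-≤ {x} {y} x≤y with m≤n⇒m<n∨m≡n x≤y
... | inj₂ refl = ≤-refl
π-mono-≤ {x} {suc y} _ | inj₁ (s≤s x≤y) = ≤-trans (π-mono-≤ x≤y) (π-≤-suc y)

π-prime : ∀ {x} → Prime (suc x) → π (suc x) ≡ suc (π x)
π-prime {x} p with prime? (suc x)
... | yes _ = refl
... | no ¬p = contradiction p ¬p

nthPrime-≤ : ∀ x {m} → 0 < m → m ≤ π x → ∃[ q ] (NthPrime m q × q ≤ x)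
nthPrime-≤ zero    0<m m≤0 = contradiction (≤-trans 0<m m≤0) (<-irrefl refl)
nthPrime-≤ (suc x) 0<m m≤π with prime? (suc x)
... | no _ = let q , pq , q≤x = nthPrime-≤ x 0<m m≤π in q , pq , m≤n⇒m≤1+n q≤x
... | yes p with m≤n⇒m<n∨m≡n m≤π
...   | inj₂ refl          = suc x , (p , π-prime p) , ≤-refl
...   | inj₁ (s≤s m≤π[x]) = let q , pq , q≤x = nthPrime-≤ x 0<m m≤π[x] in q , pq , m≤n⇒m≤1+n q≤x

≤∸⇒+≤ : ∀ k {q n} → .{{NonZero q}} → q ≤ n ∸ k → k + q ≤ n
≤∸⇒+≤ k {q} {n} q≤n∸k with ≤-total k n
... | inj₁ k≤n = subst (_≤ n) (+-comm q k) (m≤o∸n⇒m+n≤o q k≤n q≤n∸k)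
... | inj₂ n≤k = contradiction (subst (q ≤_) (m≤n⇒m∸n≡0 n≤k) q≤n∸k) (<⇒≱ (>-nonZero⁻¹ q))

module Antitone {f : ℕ → ℕ} (antitone : f Preserves _≤_ ⟶ _≥_) where

  fixedPoint-unique : ∀ {a b} → f a ≡ a → f b ≡ b → a ≡ b
  fixedPoint-unique {a} {b} fa≡a fb≡b with ≤-total a b
  ... | inj₁ a≤b = ≤-antisym a≤b (subst₂ _≤_ fb≡b fa≡a (antitone a≤b))
  ... | inj₂ b≤a = ≤-antisym (subst₂ _≤_ fa≡a fb≡b (antitone b≤a)) b≤a

  noFixedPoint : ∀ {a k} → a < f a → f (suc a) ≤ a → f k ≢ k
  noFixedPoint {a} {k} a<fa fsa≤a fk≡k with ≤-<-connex k a
  ... | inj₁ k≤a = <-irrefl refl (<-≤-trans a<fa (≤-trans (subst (f a ≤_) fk≡k (antitone k≤a)) k≤a))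
  ... | inj₂ a<k = <-irrefl refl (≤-<-trans (subst (_≤ a) fk≡k (≤-trans (antitone a<k) fsa≤a)) a<k)

  bracket⇒fixedPoint : ∀ {a k} → a ≤ f a → f (suc a) ≤ a → f k ≡ k → a ≡ k
  bracket⇒fixedPoint a≤fa fsa≤a fk≡k with m≤n⇒m<n∨m≡n a≤fa
  ... | inj₂ a≡fa = fixedPoint-unique (sym a≡fa) fk≡k
  ... | inj₁ a<fa = contradiction fk≡k (noFixedPoint a<fa fsa≤a)

kstep : ℕ → ℕ → ℕ
kstep n k = π (n ∸ k)

kstep-antitone : ∀ n → kstep n Preserves _≤_ ⟶ _≥_
kstep-antitone n k≤l = π-mono-≤ (∸-monoʳ-≤ n k≤l)

solution⇒fixedPoint : ∀ {n k} → Solves n k → kstep n k ≡ k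
solution⇒fixedPoint {k = k} (p , (_ , πp≡k) , refl) = trans (cong π (m+n∸m≡n k p)) πp≡k

kseq-next : ∀ n j {a b} → kseq n j ≡ a → kseq n (suc j) ≡ b → kstep n a ≡ b
kseq-next _ _ refl kseq[1+j]≡b = kseq[1+j]≡b

eventuallyConst⇒fixedPoint : ∀ {n k*} → EventuallyConst n k* → kstep n k* ≡ k*
eventuallyConst⇒fixedPoint {n} (J , const) = kseq-next n J (const J ≤-refl) (const (suc J) (n≤1+n J))

eventuallyAlt⇒2-cycle : ∀ {n k'} → EventuallyAlt n k' → kstep n k' ≡ suc k' × kstep n (suc k') ≡ k'
eventuallyAlt⇒2-cycle {n} (J , alt) with alt J ≤-refl | alt (suc J) (n≤1+n J)
... | inj₁ (e₁ , e₂) | inj₂ (e₃ , e₄) = kseq-next n J e₁ e₂ , kseq-next n (suc J) e₃ e₄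
... | inj₂ (e₁ , e₂) | inj₁ (e₃ , e₄) = kseq-next n (suc J) e₃ e₄ , kseq-next n J e₁ e₂
... | inj₁ (_ , e₂)  | inj₁ (e₃ , _)  = contradiction (trans (sym e₂) e₃) 1+n≢n
... | inj₂ (_ , e₂)  | inj₂ (e₃ , _)  = contradiction (trans (sym e₃) e₂) 1+n≢n

Maximal : ℕ → ℕ → Set
Maximal n m = ∀ i q → NthPrime i q → i + q ≤ n → i + q ≤ m

solution-≤⇒≤kstep : ∀ {m n j} → Solves m j → m ≤ n → j ≤ kstep n j
solution-≤⇒≤kstep {n = n} {j} (p , (_ , πp≡j) , refl) j+p≤n =
  subst (_≤ kstep n j) πp≡j (π-mono-≤ (m+n≤o⇒m≤o∸n p (subst (_≤ n) (+-comm j p) j+p≤n)))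

maximal⇒kstep-suc≤ : ∀ {m n j} → Solves m j → Maximal n m → kstep n (suc j) ≤ j
maximal⇒kstep-suc≤ {n = n} {j} (p , (_ , πp≡j) , refl) maximal with kstep n (suc j) ≤? j
... | yes kstep≤j = kstep≤j
... | no  kstep≰j with nthPrime-≤ (n ∸ suc j) z<s (≰⇒> kstep≰j)
...   | q , (q-prime , πq≡1+j) , q≤n∸[1+j] =
  contradiction (subst₂ _≤_ πq≡1+j πp≡j (π-mono-≤ (<⇒≤ q<p))) (<-irrefl refl)
  where
    1+j+q≤j+p : suc j + q ≤ j + p
    1+j+q≤j+p = maximal (suc j) q (q-prime , πq≡1+j) (≤∸⇒+≤ (suc j) {{prime⇒nonZero q-prime}} q≤n∸[1+j])
    q<p : q < p
    q<p = +-cancelˡ-≤ j (suc q) p (subst (_≤ j + p) (sym (+-suc j q)) 1+j+q≤j+p)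

theorem2 : (n : ℕ) → 4 ≤ n →
    ((k* : ℕ) → EventuallyConst n k* → (n' : ℕ) → IsNPrime n n' →
      Solves n' k* ×
      ((∃[ k ] Solves n k → n' ≡ n) × (n' ≡ n → ∃[ k ] Solves n k)) ×
      (∀ k → Solves n k → k ≡ k*)) ×
    ((k' : ℕ) → EventuallyAlt n k' → ¬ (∃[ k ] Solves n k))
theorem2 n _ = constantCase , alternatingCase
  where
    open Antitone (kstep-antitone n)

    constantCase : (k* : ℕ) → EventuallyConst n k* → (n' : ℕ) → IsNPrime n n' →
      Solves n' k* ×
      ((∃[ k ] Solves n k → n' ≡ n) × (n' ≡ n → ∃[ k ] Solves n k)) ×
      (∀ k → Solves n k → k ≡ k*)
    constantCase k* const n' ((j , j-solves) , n'≤n , maximal) =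
      subst (Solves n') j≡k* j-solves ,
      ((λ { (k , (p , p-nth , refl)) → ≤-antisym n'≤n (maximal k p p-nth ≤-refl) }) ,
       (λ { refl → j , j-solves })) ,
      (λ k k-solves → fixedPoint-unique (solution⇒fixedPoint k-solves) k*-fixed)
      where
        k*-fixed : kstep n k* ≡ k*
        k*-fixed = eventuallyConst⇒fixedPoint const
        j≡k* : j ≡ k*
        j≡k* = bracket⇒fixedPoint (solution-≤⇒≤kstep j-solves n'≤n)
                 (maximal⇒kstep-suc≤ j-solves maximal) k*-fixed

    alternatingCase : (k' : ℕ) → EventuallyAlt n k' → ¬ (∃[ k ] Solves n k)
    alternatingCase k' alt (k , k-solves) with eventuallyAlt⇒2-cycle alt
    ... | up , down = noFixedPoint (≤-reflexive (sym up)) (≤-reflexive down) (solution⇒fixedPoint k-solves)
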